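{- Let $\mathcal{L}$ and $\mathcal{M}$ be set systems and let $R\subseteq(\bigcup\mathcal{L})\times P(\bigcup\mathcal{M})$. Let $\mathfrak{O}_R:P(\bigcup\mathcal{M})\to P(\bigcup\mathcal{L})$ be given by $\mathfrak{O}_R(A)=\{x\in\bigcup\mathcal{L}:\exists v\subseteq A,\ R(x,v)\}$. Then for every $A\in\mathcal{M}$, the set $\mathfrak{O}_R(A)$ is upper-closed with respect to the quasi-ordering $Q_R(\mathrm{qo}(\mathcal{M}))$; that is, $\mathfrak{O}_R[\mathcal{M}]\subseteq\mathrm{ss}(Q_R(\mathrm{qo}(\mathcal{M})))$.
   Context: A set system over $T$ is a family $\mathcal{L}\subseteq P(T)$. For a set system $\mathcal{M}$, $\mathrm{qo}(\mathcal{M})=(\bigcup\mathcal{M},\preceq)$ where $x\preceq y$ iff for every $M\in\mathcal{M}$, $x\in M$ implies $y\in M$. For a quasi-ordering $(X,\preceq)$, the powerset ordering on $P(X)$ is $v\preceq^\forall_\exists v'$ iff for every $x'\in v'$ there is $x\in v$ with $x\preceq x'$. Given $R\subseteq(\bigcup\mathcal{L})\times P(\bigcup\mathcal{M})$ and a quasi-ordering $\mathcal{X}=(\bigcup\mathcal{M},\preceq)$, $Q_R(\mathcal{X})$ is the relation $\sqsubseteq$ on $\bigcup\mathcal{L}$ with $x\sqsubseteq x'$ iff for every $v$ with $R(x,v)$ there is $v'$ with $R(x',v')$ and $v\preceq^\forall_\exists v'$ (this is a quasi-ordering). For a quasi-ordering $\mathcal{Y}=(Y,\sqsubseteq)$,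 $\mathrm{ss}(\mathcal{Y})$ is the set of upper-closed subsets of $Y$, i.e. $A\subseteq Y$ with $x\in A$, $x\sqsubseteq y$ implying $y\in A$. -}

module Defs where

open import Level using (Level; _⊔_) renaming (suc to lsuc)
open import Data.Product using (Σ; _×_; ∃-syntax)

Subset : Set → Set₁
Subset T = T → Set

-- predicates of arbitrary level (e.g. ⋃ 𝓛 lives in Set₁)
_⊆_ : {T : Set} {a b : Level} → (T → Set a) → (T → Set b) → Set (a ⊔ b)
A ⊆ B = ∀ x → A x → B x

SetSystem : Set → Set₁
SetSystem T = Subset T → Set

⋃ : {T : Set} → SetSystem T → T → Set₁
⋃ 𝓛 x = Σ (Subset _) λ M → 𝓛 M × M x

-- qo(𝓜): x ≼ y iff for every M ∈ 𝓜, x ∈ M implies y ∈ M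
-- (the carrier is ⋃ 𝓜; the relation is only used on elements of ⋃ 𝓜).
qo : {T : Set} → SetSystem T → T → T → Set₁
qo 𝓜 x y = ∀ (M : Subset _) → 𝓜 M → M x → M y

PowOrd : {U : Set} → (U → U → Set₁) → Subset U → Subset U → Set₁
PowOrd _≼_ v v' = ∀ x' → v' x' → Σ _ λ x → v x × (x ≼ x')

Q : {S U : Set} (𝓜 : SetSystem U) (R : S → Subset U → Set)
  → (U → U → Set₁) → S → S → Set₁
Q 𝓜 R _≼_ x x' = ∀ (v : Subset _) → v ⊆ ⋃ 𝓜 → R x v →
  Σ (Subset _) λ v' → (v' ⊆ ⋃ 𝓜) × R x' v' × PowOrd _≼_ v v'

UpperClosed : {S : Set} (Y : S → Set₁) (_⊑_ : S → S → Set₁) → (S → Set₁) → Set₁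
UpperClosed Y _⊑_ A = (A ⊆ Y) × (∀ x y → Y x → Y y → A x → x ⊑ y → A y)

𝔒 : {S U : Set} (𝓛 : SetSystem S) (R : S → Subset U → Set) → Subset U → S → Set₁
𝔒 𝓛 R A x = ⋃ 𝓛 x × Σ (Subset _) λ v → (v ⊆ A) × R x v

-- Every A ∈ 𝓜 is upper-closed for qo 𝓜, as A itself is one of the sets quantified over
-- in its definition. If v ⊆ A witnesses x ∈ 𝔒_R(A) and x ⊑ y, the v' with R(y,v') and
-- v ≼∀∃ v' lies above v pointwise, so v' ⊆ A by upper-closedness and y ∈ 𝔒_R(A).

module Submission where

open import Defs
open import Data.Product using (_×_; _,_; proj₁; proj₂)

member⇒qo-upward : {U : Set} (𝓜 : SetSystem U) {A : Subset U} → 𝓜 A →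
  ∀ {x y} → A x → qo 𝓜 x y → A y
member⇒qo-upward 𝓜 𝓜A Ax x≼y = x≼y _ 𝓜A Ax

PowOrd-⊆-upward : {U : Set} {_≼_ : U → U → Set₁} {A v v' : Subset U} →
  (∀ {x y} → A x → x ≼ y → A y) → v ⊆ A → PowOrd _≼_ v v' → v' ⊆ A
PowOrd-⊆-upward A-upward v⊆A v≼v' x' v'x' with v≼v' x' v'x'
... | x , vx , x≼x' = A-upward (v⊆A x vx) x≼x'

𝔒-upward : {S U : Set} (𝓛 : SetSystem S) (𝓜 : SetSystem U)
  (R : S → Subset U → Set) → (∀ x v → R x v → v ⊆ ⋃ 𝓜) →
  {_≼_ : U → U → Set₁} {A : Subset U} → (∀ {x y} → A x → x ≼ y → A y) →
  ∀ {x y} → ⋃ 𝓛 y → 𝔒 𝓛 R A x → Q 𝓜 R _≼_ x y → 𝔒 𝓛 R A y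
𝔒-upward 𝓛 𝓜 R R⊆⋃𝓜 A-upward {x} 𝓛y (_ , v , v⊆A , Rxv) x⊑y
  with x⊑y v (R⊆⋃𝓜 x v Rxv) Rxv
... | v' , _ , Ryv' , v≼v' = 𝓛y , v' , PowOrd-⊆-upward A-upward v⊆A v≼v' , Ryv'

theorem1 : {S U : Set} (𝓛 : SetSystem S) (𝓜 : SetSystem U)
    → (R : S → Subset U → Set)
    → (∀ x v → R x v → ⋃ 𝓛 x × (v ⊆ ⋃ 𝓜))
    → (A : Subset U) → 𝓜 A
    → UpperClosed (⋃ 𝓛) (Q 𝓜 R (qo 𝓜)) (𝔒 𝓛 R A)
theorem1 𝓛 𝓜 R R-typed A 𝓜A =
    (λ _ → proj₁)
  , λ _ _ _ 𝓛y → 𝔒-upward 𝓛 𝓜 R (λ x v Rxv → proj₂ (R-typed x v Rxv))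
                   (member⇒qo-upward 𝓜 𝓜A) 𝓛y
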